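{- For all integers $n, k \geq 1$ with $n \geq k$, $$\sum_{k \le i \le n} \frac{s(n,i)\, S(i,k)}{i} = (-1)^{n-k}\frac{(n-1)!}{k!} \sum_{\ell=0}^{n-k} \frac{(-1)^\ell}{\ell!} B_\ell^*.$$
   Context: $X^{\underline{n}} := X(X-1)\cdots(X-n+1)$. The (signed) Stirling numbers of the first kind $s(n,k)$ are defined by $X^{\underline{n}} = \sum_{k=0}^{n} s(n,k) X^k$, and the Stirling numbers of the second kind $S(n,k)$ by $X^n = \sum_{k=0}^{n} S(n,k) X^{\underline{k}}$ ($n\ge0$), with $s(n,k)=S(n,k)=0$ for $n<k$. The Bernoulli numbers of the second kind $B_n^*$ are defined by $\frac{t}{\log(1+t)} = \sum_{n\ge 0} B_n^* \frac{t^n}{n!}$ (equivalently $B_n^* = \int_0^1 x^{\underline{n}}\,dx$). -}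

module Defs where

open import Data.Nat as ℕ using (ℕ; zero; suc; _∸_; _!)
open import Data.Integer as ℤ using (ℤ; +_; -[1+_])
open import Data.Rational as ℚ using (ℚ; 0ℚ)

-- Signed Stirling numbers of the first kind s(n,k):
-- the coefficient of X^k in X(X-1)...(X-n+1), via the recurrence coming from
-- X^{\underline{n+1}} = X^{\underline{n}} * (X - n).
s : ℕ → ℕ → ℤ
s zero    zero    = + 1
s zero    (suc k) = + 0
s (suc n) zero    = + 0
s (suc n) (suc k) = s n k ℤ.- (+ n) ℤ.* s n (suc k)

-- Stirling numbers of the second kind S(n,k), via the recurrence coming from
-- X * X^{\underline{k}} = X^{\underline{k+1}} + k X^{\underline{k}}.
S : ℕ → ℕ → ℤ
S zero    zero    = + 1
S zero    (suc k) = + 0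
S (suc n) zero    = + 0
S (suc n) (suc k) = S n k ℤ.+ (+ suc k) ℤ.* S n (suc k)

-- a / d as a rational number (only ever used with d ≥ 1; the d = 0 case is a dummy).
_/ℕ_ : ℤ → ℕ → ℚ
a /ℕ zero    = 0ℚ
a /ℕ (suc d) = a ℚ./ suc d

sumFrom : ℕ → ℕ → (ℕ → ℚ) → ℚ
sumFrom a zero      f = 0ℚ
sumFrom a (suc len) f = f a ℚ.+ sumFrom (suc a) len f

Σ[_≤i≤_] : ℕ → ℕ → (ℕ → ℚ) → ℚ
Σ[ a ≤i≤ b ] f = sumFrom a (suc b ∸ a) f

sgn : ℕ → ℚ
sgn m = (-[1+ 0 ] ℤ.^ m) /ℕ 1

-- Bernoulli numbers of the second kind: B*_n = ∫_0^1 x^{\underline n} dx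
--   = Σ_{k=0}^{n} s(n,k) / (k+1).
Bstar : ℕ → ℚ
Bstar n = Σ[ 0 ≤i≤ n ] (λ k → s n k /ℕ suc k)

-- Let A(n,k) = Σ_i s(n,i) S(i,k) / i. Expand S(i+1,k+2) = Σ_m C(i,m) S(m,k+1) and exchange the two sums:
-- by the absorption identity C(i,m) / i = C(i-1,m-1) / m and Σ_j s(n+1,j+1) C(j,p) = s(n,p) (the
-- coefficients of X^{\underline{n+1}} / X = (X-1)^{\underline n} after substituting X ↦ X+1), the inner sums become
-- Σ_i s(n+1,i) C(i,m) / i = s(n,m-1) / m. This yields the shift relation (k+2) A(n+1,k+2) = n A(n,k+1),
-- which reduces the claim to k = 1. There s(m+1,j+1) = s(m,j) - m s(m,j+1) gives a(m) + m a(m-1) = B*_m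
-- for a(m) = A(m+1,1), a first-order linear recurrence solved by a(m) = (-1)^m m! Σ_{ℓ ≤ m} (-1)^ℓ B*_ℓ / ℓ!.
module Submission where

open import Defs
open import Data.Nat using (ℕ; _≤_; _∸_; _!)
open import Data.Integer using (+_)
open import Data.Integer as ℤ using ()
open import Data.Rational using (ℚ; _+_; _*_)
open import Relation.Binary.PropositionalEquality using (_≡_)

open import Data.Integer using (ℤ; -[1+_])
import Data.Integer.Properties as ℤ
import Data.Integer.Tactic.RingSolver as ℤ-Solver
open import Data.Nat as ℕ using (zero; suc; _<_; z≤n; s≤s; NonZero)
open import Data.Nat.Combinatorics using (_C_; nC1≡n; nCk+nC[k+1]≡[n+1]C[k+1])
import Data.Nat.Properties as ℕ
import Data.Nat.Tactic.RingSolver as ℕ-Solver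
open import Data.Product using (_,_)
open import Data.Rational as ℚ using (0ℚ; 1ℚ; -_; _-_)
open import Data.Rational.Properties
open import Algebra.Properties.Ring +-*-ring using (+-cancelˡ; +-cancelʳ)
open import Data.Rational.Unnormalised as ℚᵘ using (mkℚᵘ; *≡*)
import Data.Rational.Unnormalised.Properties as ℚᵘ
open import Function using (_∘_)
open import Level using (0ℓ)
open import Relation.Binary.PropositionalEquality using (refl; sym; trans; cong; cong₂; module ≡-Reasoning)
open import Relation.Nullary.Decidable using (dec⇒maybe)
open import Tactic.RingSolver using (solve-∀)
import Tactic.RingSolver.Core.AlmostCommutativeRing as ACR

open ≡-Reasoning

ℚ-ring : ACR.AlmostCommutativeRing 0ℓ 0ℓ
ℚ-ring = ACR.fromCommutativeRing +-*-commutativeRing (λ x → dec⇒maybe (0ℚ ≟ x))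

fromℚᵘ-homo-+ : ∀ p q → ℚ.fromℚᵘ (p ℚᵘ.+ q) ≡ ℚ.fromℚᵘ p + ℚ.fromℚᵘ q
fromℚᵘ-homo-+ p q = toℚᵘ-injective (ℚᵘ.≃-trans (toℚᵘ-fromℚᵘ (p ℚᵘ.+ q)) (ℚᵘ.≃-sym
  (ℚᵘ.≃-trans (toℚᵘ-homo-+ (ℚ.fromℚᵘ p) (ℚ.fromℚᵘ q))
              (ℚᵘ.+-cong (toℚᵘ-fromℚᵘ p) (toℚᵘ-fromℚᵘ q)))))

fromℚᵘ-homo-* : ∀ p q → ℚ.fromℚᵘ (p ℚᵘ.* q) ≡ ℚ.fromℚᵘ p * ℚ.fromℚᵘ q
fromℚᵘ-homo-* p q = toℚᵘ-injective (ℚᵘ.≃-trans (toℚᵘ-fromℚᵘ (p ℚᵘ.* q)) (ℚᵘ.≃-sym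
  (ℚᵘ.≃-trans (toℚᵘ-homo-* (ℚ.fromℚᵘ p) (ℚ.fromℚᵘ q))
              (ℚᵘ.*-cong (toℚᵘ-fromℚᵘ p) (toℚᵘ-fromℚᵘ q)))))

-- Through _/ℕ_, so that sgn m is fromℤ ((-1)^m) by definition.
fromℤ : ℤ → ℚ
fromℤ a = a /ℕ 1

fromℕ : ℕ → ℚ
fromℕ n = fromℤ (+ n)

1/ℕ_ : ℕ → ℚ
1/ℕ d = (+ 1) /ℕ d

/ℕ-cross : ∀ a b c d → a ℤ.* + suc d ≡ c ℤ.* + suc b → a /ℕ suc b ≡ c /ℕ suc d
/ℕ-cross a b c d eq = fromℚᵘ-cong {mkℚᵘ a b} {mkℚᵘ c d} (*≡* eq)

/ℕ-*-/ℕ : ∀ a b c d → a /ℕ b * c /ℕ d ≡ (a ℤ.* c) /ℕ (b ℕ.* d)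
/ℕ-*-/ℕ a zero    c d       = *-zeroˡ (c /ℕ d)
/ℕ-*-/ℕ a (suc b) c zero    = trans (*-zeroʳ (a /ℕ suc b)) (cong ((a ℤ.* c) /ℕ_) (sym (ℕ.*-zeroʳ b)))
/ℕ-*-/ℕ a (suc b) c (suc d) = sym (fromℚᵘ-homo-* (mkℚᵘ a b) (mkℚᵘ c d))

fromℤ-* : ∀ a b → fromℤ (a ℤ.* b) ≡ fromℤ a * fromℤ b
fromℤ-* a b = sym (/ℕ-*-/ℕ a 1 b 1)

fromℤ-+ : ∀ a b → fromℤ (a ℤ.+ b) ≡ fromℤ a + fromℤ b
fromℤ-+ a b = trans (/ℕ-cross (a ℤ.+ b) 0 (a ℤ.* + 1 ℤ.+ b ℤ.* + 1) 0 (cross a b))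
                    (fromℚᵘ-homo-+ (mkℚᵘ a 0) (mkℚᵘ b 0))
  where
  cross : ∀ a b → (a ℤ.+ b) ℤ.* + 1 ≡ (a ℤ.* + 1 ℤ.+ b ℤ.* + 1) ℤ.* + 1
  cross = ℤ-Solver.solve-∀

fromℕ-+ : ∀ m n → fromℕ (m ℕ.+ n) ≡ fromℕ m + fromℕ n
fromℕ-+ m n = trans (cong fromℤ (ℤ.pos-+ m n)) (fromℤ-+ (+ m) (+ n))

fromℕ-* : ∀ m n → fromℕ (m ℕ.* n) ≡ fromℕ m * fromℕ n
fromℕ-* m n = trans (cong fromℤ (ℤ.pos-* m n)) (fromℤ-* (+ m) (+ n))

fromℕ-suc : ∀ n → fromℕ (suc n) ≡ 1ℚ + fromℕ n
fromℕ-suc = fromℕ-+ 1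

x+ny+y≡x+[n+1]y : ∀ x n y → x + fromℕ n * y + y ≡ x + fromℕ (suc n) * y
x+ny+y≡x+[n+1]y x n y = trans (rearrange x (fromℕ n) y) (cong (λ c → x + c * y) (sym (fromℕ-suc n)))
  where
  rearrange : ∀ x c y → x + c * y + y ≡ x + (1ℚ + c) * y
  rearrange = solve-∀ ℚ-ring

/ℕ≡*1/ℕ : ∀ a d → a /ℕ d ≡ fromℤ a * 1/ℕ d
/ℕ≡*1/ℕ a d = sym (trans (/ℕ-*-/ℕ a 1 (+ 1) d) (cong₂ _/ℕ_ (ℤ.*-identityʳ a) (ℕ.*-identityˡ d)))

fromℕ*1/ℕ≡1 : ∀ n .{{_ : NonZero n}} → fromℕ n * 1/ℕ n ≡ 1ℚ
fromℕ*1/ℕ≡1 (suc d) = begin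
  fromℕ (suc d) * 1/ℕ suc d        ≡⟨ /ℕ-*-/ℕ (+ suc d) 1 (+ 1) (suc d) ⟩
  (+ suc d ℤ.* + 1) /ℕ (1 ℕ.* suc d) ≡⟨ cong₂ _/ℕ_ (ℤ.*-identityʳ (+ suc d)) (ℕ.*-identityˡ (suc d)) ⟩
  (+ suc d) /ℕ suc d               ≡⟨ /ℕ-cross (+ suc d) d (+ 1) 0 (ℤ.*-comm (+ suc d) (+ 1)) ⟩
  1ℚ                               ∎

fromℕ*x≡y⇒x≡y*1/ℕ : ∀ n .{{_ : NonZero n}} x y → fromℕ n * x ≡ y → x ≡ y * 1/ℕ n
fromℕ*x≡y⇒x≡y*1/ℕ n x y nx≡y = begin
  x                          ≡⟨ *-identityˡ x ⟨
  1ℚ * x                     ≡⟨ cong (_* x) (fromℕ*1/ℕ≡1 n) ⟨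
  fromℕ n * 1/ℕ n * x        ≡⟨ rearrange (fromℕ n) (1/ℕ n) x ⟩
  fromℕ n * x * 1/ℕ n        ≡⟨ cong (_* 1/ℕ n) nx≡y ⟩
  y * 1/ℕ n                  ∎
  where
  rearrange : ∀ a b c → a * b * c ≡ a * c * b
  rearrange = solve-∀ ℚ-ring

∑< : ℕ → (ℕ → ℚ) → ℚ
∑< zero    f = 0ℚ
∑< (suc M) f = f 0 + ∑< M (f ∘ suc)

infix 6.5 ∑<
syntax ∑< M (λ i → e) = ∑[ i < M ] e

∑<-cong : ∀ M {f g : ℕ → ℚ} → (∀ i → i < M → f i ≡ g i) → ∑< M f ≡ ∑< M g
∑<-cong zero    f≡g = refl
∑<-cong (suc M) f≡g = cong₂ _+_ (f≡g 0 (s≤s z≤n)) (∑<-cong M (λ i i<M → f≡g (suc i) (s≤s i<M)))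

∑<-vanish : ∀ M {f : ℕ → ℚ} → (∀ i → i < M → f i ≡ 0ℚ) → ∑< M f ≡ 0ℚ
∑<-vanish zero    f≡0 = refl
∑<-vanish (suc M) f≡0 =
  trans (cong₂ _+_ (f≡0 0 (s≤s z≤n)) (∑<-vanish M (λ i i<M → f≡0 (suc i) (s≤s i<M)))) (+-identityʳ 0ℚ)

∑<-+ : ∀ M (f g : ℕ → ℚ) → ∑[ i < M ] (f i + g i) ≡ ∑< M f + ∑< M g
∑<-+ zero    f g = refl
∑<-+ (suc M) f g = trans (cong (_+_ (f 0 + g 0)) (∑<-+ M (f ∘ suc) (g ∘ suc)))
                         (+-medial (f 0) (g 0) (∑< M (f ∘ suc)) (∑< M (g ∘ suc)))
  where
  +-medial : ∀ a b c d → a + b + (c + d) ≡ a + c + (b + d)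
  +-medial = solve-∀ ℚ-ring

*-distribˡ-∑< : ∀ M c (f : ℕ → ℚ) → c * ∑< M f ≡ ∑[ i < M ] c * f i
*-distribˡ-∑< zero    c f = *-zeroʳ c
*-distribˡ-∑< (suc M) c f =
  trans (*-distribˡ-+ c (f 0) (∑< M (f ∘ suc))) (cong (_+_ (c * f 0)) (*-distribˡ-∑< M c (f ∘ suc)))

*-distribʳ-∑< : ∀ M c (f : ℕ → ℚ) → ∑< M f * c ≡ ∑[ i < M ] f i * c
*-distribʳ-∑< M c f = trans (*-comm (∑< M f) c) (trans (*-distribˡ-∑< M c f) (∑<-cong M (λ i _ → *-comm c (f i))))

∑<-linear : ∀ M (f g : ℕ → ℚ) c → ∑[ i < M ] (f i + c * g i) ≡ ∑< M f + c * ∑< M g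
∑<-linear M f g c = trans (∑<-+ M f (λ i → c * g i)) (cong (_+_ (∑< M f)) (sym (*-distribˡ-∑< M c g)))

∑<-comm : ∀ M N (f : ℕ → ℕ → ℚ) → ∑[ i < M ] ∑[ j < N ] f i j ≡ ∑[ j < N ] ∑[ i < M ] f i j
∑<-comm zero    N f = sym (∑<-vanish N (λ _ _ → refl))
∑<-comm (suc M) N f = trans (cong (_+_ (∑< N (f 0))) (∑<-comm M N (f ∘ suc))) (sym (∑<-+ N (f 0) _))

∑<-extend : ∀ M {f : ℕ → ℚ} → f M ≡ 0ℚ → ∑< (suc M) f ≡ ∑< M f
∑<-extend zero    f0≡0 = trans (+-identityʳ _) f0≡0
∑<-extend (suc M) {f} fM≡0 = cong (_+_ (f 0)) (∑<-extend M {f ∘ suc} fM≡0)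

∑<-split : ∀ k L (f : ℕ → ℚ) → ∑< (k ℕ.+ L) f ≡ ∑< k f + ∑[ i < L ] f (k ℕ.+ i)
∑<-split zero    L f = sym (+-identityˡ (∑< L f))
∑<-split (suc k) L f = trans (cong (_+_ (f 0)) (∑<-split k L (f ∘ suc))) (sym (+-assoc (f 0) _ _))

sumFrom≡∑< : ∀ a L (f : ℕ → ℚ) → sumFrom a L f ≡ ∑[ i < L ] f (a ℕ.+ i)
sumFrom≡∑< a zero    f = refl
sumFrom≡∑< a (suc L) f = cong₂ _+_ (cong f (sym (ℕ.+-identityʳ a)))
  (trans (sumFrom≡∑< (suc a) L f) (∑<-cong L (λ i _ → cong f (sym (ℕ.+-suc a i)))))

sumFrom-suc : ∀ a L (f : ℕ → ℚ) → sumFrom a (suc L) f ≡ sumFrom a L f + f (a ℕ.+ L)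
sumFrom-suc a zero    f = trans (+-identityʳ (f a)) (trans (cong f (sym (ℕ.+-identityʳ a))) (sym (+-identityˡ _)))
sumFrom-suc a (suc L) f = begin
  f a + sumFrom (suc a) (suc L) f              ≡⟨ cong (_+_ (f a)) (sumFrom-suc (suc a) L f) ⟩
  f a + (sumFrom (suc a) L f + f (suc a ℕ.+ L)) ≡⟨ +-assoc (f a) (sumFrom (suc a) L f) (f (suc a ℕ.+ L)) ⟨
  f a + sumFrom (suc a) L f + f (suc a ℕ.+ L)   ≡⟨ cong (λ i → f a + sumFrom (suc a) L f + f i) (ℕ.+-suc a L) ⟨
  f a + sumFrom (suc a) L f + f (a ℕ.+ suc L)   ∎

∑<≡sumFrom : ∀ k M (f : ℕ → ℚ) → k ≤ M → (∀ i → i < k → f i ≡ 0ℚ) → ∑< M f ≡ sumFrom k (M ∸ k) f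
∑<≡sumFrom k M f k≤M f≡0 = begin
  ∑< M f                                      ≡⟨ cong (λ L → ∑< L f) (ℕ.m+[n∸m]≡n k≤M) ⟨
  ∑< (k ℕ.+ (M ∸ k)) f                        ≡⟨ ∑<-split k (M ∸ k) f ⟩
  ∑< k f + ∑[ i < M ∸ k ] f (k ℕ.+ i)         ≡⟨ cong₂ _+_ (∑<-vanish k f≡0) (sym (sumFrom≡∑< k (M ∸ k) f)) ⟩
  0ℚ + sumFrom k (M ∸ k) f                    ≡⟨ +-identityˡ _ ⟩
  sumFrom k (M ∸ k) f                         ∎

sgn-suc : ∀ m → sgn (suc m) ≡ - sgn m
sgn-suc m = begin
  sgn (suc m)       ≡⟨ fromℤ-* -[1+ 0 ] (-[1+ 0 ] ℤ.^ m) ⟩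
  - 1ℚ * sgn m      ≡⟨ neg-distribˡ-* 1ℚ (sgn m) ⟨
  - (1ℚ * sgn m)    ≡⟨ cong -_ (*-identityˡ (sgn m)) ⟩
  - sgn m           ∎

sgn-sq : ∀ m → sgn m * sgn m ≡ 1ℚ
sgn-sq zero    = refl
sgn-sq (suc m) = begin
  sgn (suc m) * sgn (suc m)  ≡⟨ cong₂ _*_ (sgn-suc m) (sgn-suc m) ⟩
  - sgn m * - sgn m          ≡⟨ neg*neg (sgn m) ⟩
  sgn m * sgn m              ≡⟨ sgn-sq m ⟩
  1ℚ                         ∎
  where
  neg*neg : ∀ x → - x * - x ≡ x * x
  neg*neg = solve-∀ ℚ-ring

first-order-recurrence : ∀ (a c : ℕ → ℚ) → a 0 ≡ c 0 → (∀ m → a (suc m) + fromℕ (suc m) * a m ≡ c (suc m)) →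
  ∀ m → a m ≡ fromℕ (m !) * (sgn m * Σ[ 0 ≤i≤ m ] (λ ℓ → sgn ℓ * 1/ℕ (ℓ !) * c ℓ))
first-order-recurrence a c a₀ step zero = trans a₀ (drop-units (c 0))
  where
  drop-units : ∀ x → x ≡ 1ℚ * (1ℚ * (1ℚ * 1ℚ * x + 0ℚ))
  drop-units = solve-∀ ℚ-ring
first-order-recurrence a c a₀ step (suc m) = +-cancelʳ (fromℕ (suc m) * a m) _ _ (begin
  a (suc m) + fromℕ (suc m) * a m
    ≡⟨ step m ⟩
  c (suc m)
    ≡⟨ closed-form-step ⟨
  F′ * (sgn (suc m) * Σ[ 0 ≤i≤ suc m ] g) + n * a m ∎)
  where
  g : ℕ → ℚ
  g ℓ = sgn ℓ * 1/ℕ (ℓ !) * c ℓ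
  n = fromℕ (suc m)
  f = fromℕ (m !)
  F′ = fromℕ (suc m !)
  q = 1/ℕ (suc m !)
  σ = sgn m
  Σₘ = Σ[ 0 ≤i≤ m ] g
  c′ = c (suc m)
  closed-form-step : F′ * (sgn (suc m) * Σ[ 0 ≤i≤ suc m ] g) + n * a m ≡ c′
  closed-form-step = begin
    F′ * (sgn (suc m) * Σ[ 0 ≤i≤ suc m ] g) + n * a m
      ≡⟨ cong₂ (λ Σ′ aₘ → F′ * (sgn (suc m) * Σ′) + n * aₘ)
               (sumFrom-suc 0 (suc m) g) (first-order-recurrence a c a₀ step m) ⟩
    F′ * (sgn (suc m) * (Σₘ + sgn (suc m) * q * c′)) + n * (f * (σ * Σₘ))
      ≡⟨ cong (λ τ → F′ * (τ * (Σₘ + τ * q * c′)) + n * (f * (σ * Σₘ))) (sgn-suc m) ⟩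
    F′ * (- σ * (Σₘ + - σ * q * c′)) + n * (f * (σ * Σₘ))
      ≡⟨ expand F′ σ Σₘ q c′ n f ⟩
    σ * σ * (F′ * q) * c′ + (n * f - F′) * (σ * Σₘ)
      ≡⟨ cong₂ (λ u v → u * v * c′ + (n * f - F′) * (σ * Σₘ))
               (sgn-sq m) (fromℕ*1/ℕ≡1 (suc m !) {{suc m ℕ.!≢0}}) ⟩
    1ℚ * 1ℚ * c′ + (n * f - F′) * (σ * Σₘ)
      ≡⟨ cong (λ d → 1ℚ * 1ℚ * c′ + d * (σ * Σₘ))
              (trans (cong (_- F′) (sym (fromℕ-* (suc m) (m !)))) (+-inverseʳ F′)) ⟩
    1ℚ * 1ℚ * c′ + 0ℚ * (σ * Σₘ)
      ≡⟨ simplify c′ (σ * Σₘ) ⟩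
    c′ ∎
    where
    expand : ∀ F s Σ q c n f →
      F * (- s * (Σ + - s * q * c)) + n * (f * (s * Σ)) ≡ s * s * (F * q) * c + (n * f - F) * (s * Σ)
    expand = solve-∀ ℚ-ring
    simplify : ∀ x y → 1ℚ * 1ℚ * x + 0ℚ * y ≡ x
    simplify = solve-∀ ℚ-ring

s-vanish : ∀ {n k} → n < k → s n k ≡ + 0
s-vanish {zero}  {suc k} _         = refl
s-vanish {suc n} {suc k} (s≤s n<k)
  rewrite s-vanish n<k | s-vanish (ℕ.m<n⇒m<1+n n<k) | ℤ.*-zeroʳ (+ n) = refl

S-vanish : ∀ {n k} → n < k → S n k ≡ + 0
S-vanish {zero}  {suc k} _         = refl
S-vanish {suc n} {suc k} (s≤s n<k)
  rewrite S-vanish n<k | S-vanish (ℕ.m<n⇒m<1+n n<k) | ℤ.*-zeroʳ (+ suc k) = refl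

S[n+1,1]≡1 : ∀ n → S (suc n) 1 ≡ + 1
S[n+1,1]≡1 zero    = refl
S[n+1,1]≡1 (suc n) rewrite S[n+1,1]≡1 n = refl

sℚ : ℕ → ℕ → ℚ
sℚ n k = fromℤ (s n k)

Sℚ : ℕ → ℕ → ℚ
Sℚ n k = fromℤ (S n k)

n*s[n,0]≡0 : ∀ n → fromℕ n * sℚ n 0 ≡ 0ℚ
n*s[n,0]≡0 zero    = refl
n*s[n,0]≡0 (suc n) = *-zeroʳ (fromℕ (suc n))

sℚ-suc : ∀ n k → sℚ (suc n) (suc k) + fromℕ n * sℚ n (suc k) ≡ sℚ n k
sℚ-suc n k = begin
  sℚ (suc n) (suc k) + fromℕ n * sℚ n (suc k)
    ≡⟨ cong (_+_ (sℚ (suc n) (suc k))) (fromℤ-* (+ n) (s n (suc k))) ⟨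
  sℚ (suc n) (suc k) + fromℤ (+ n ℤ.* s n (suc k)) ≡⟨ fromℤ-+ (s (suc n) (suc k)) (+ n ℤ.* s n (suc k)) ⟨
  fromℤ (s n k ℤ.- + n ℤ.* s n (suc k) ℤ.+ + n ℤ.* s n (suc k))
    ≡⟨ cong fromℤ (sub-add (s n k) (+ n ℤ.* s n (suc k))) ⟩
  sℚ n k                                           ∎
  where
  sub-add : ∀ a b → a ℤ.- b ℤ.+ b ≡ a
  sub-add = ℤ-Solver.solve-∀

Sℚ-suc : ∀ n k → Sℚ (suc n) (suc k) ≡ Sℚ n k + fromℕ (suc k) * Sℚ n (suc k)
Sℚ-suc n k = trans (fromℤ-+ (S n k) (+ suc k ℤ.* S n (suc k)))
                   (cong (_+_ (Sℚ n k)) (fromℤ-* (+ suc k) (S n (suc k))))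

[k+1]*[n+1]C[k+1]≡[n+1]*nCk : ∀ n k → suc k ℕ.* (suc n C suc k) ≡ suc n ℕ.* (n C k)
[k+1]*[n+1]C[k+1]≡[n+1]*nCk zero    zero    = refl
[k+1]*[n+1]C[k+1]≡[n+1]*nCk zero    (suc k) = ℕ.*-zeroʳ (suc (suc k))
[k+1]*[n+1]C[k+1]≡[n+1]*nCk (suc n) zero    = trans (ℕ.*-identityˡ _) (trans (nC1≡n (suc (suc n))) (sym (ℕ.*-identityʳ _)))
[k+1]*[n+1]C[k+1]≡[n+1]*nCk (suc n) (suc k) = begin
  suc (suc k) ℕ.* (suc (suc n) C suc (suc k))
    ≡⟨ cong (suc (suc k) ℕ.*_) (nCk+nC[k+1]≡[n+1]C[k+1] (suc n) (suc k)) ⟨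
  suc (suc k) ℕ.* (suc n C suc k ℕ.+ suc n C suc (suc k))
    ≡⟨ expand k (suc n C suc k) (suc n C suc (suc k)) ⟩
  suc n C suc k ℕ.+ suc k ℕ.* (suc n C suc k) ℕ.+ suc (suc k) ℕ.* (suc n C suc (suc k))
    ≡⟨ cong₂ (λ x y → suc n C suc k ℕ.+ x ℕ.+ y)
             ([k+1]*[n+1]C[k+1]≡[n+1]*nCk n k) ([k+1]*[n+1]C[k+1]≡[n+1]*nCk n (suc k)) ⟩
  suc n C suc k ℕ.+ suc n ℕ.* (n C k) ℕ.+ suc n ℕ.* (n C suc k)
    ≡⟨ collect n (suc n C suc k) (n C k) (n C suc k) ⟩
  suc n C suc k ℕ.+ suc n ℕ.* (n C k ℕ.+ n C suc k)
    ≡⟨ cong (λ x → suc n C suc k ℕ.+ suc n ℕ.* x) (nCk+nC[k+1]≡[n+1]C[k+1] n k) ⟩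
  suc n C suc k ℕ.+ suc n ℕ.* (suc n C suc k)
    ≡⟨⟩
  suc (suc n) ℕ.* (suc n C suc k) ∎
  where
  expand : ∀ k a b → suc (suc k) ℕ.* (a ℕ.+ b) ≡ a ℕ.+ suc k ℕ.* a ℕ.+ suc (suc k) ℕ.* b
  expand = ℕ-Solver.solve-∀
  collect : ∀ n c x y → c ℕ.+ suc n ℕ.* x ℕ.+ suc n ℕ.* y ≡ c ℕ.+ suc n ℕ.* (x ℕ.+ y)
  collect = ℕ-Solver.solve-∀

pascalℚ : ∀ n k → fromℕ (n C k) + fromℕ (n C suc k) ≡ fromℕ (suc n C suc k)
pascalℚ n k = trans (sym (fromℕ-+ (n C k) (n C suc k))) (cong fromℕ (nCk+nC[k+1]≡[n+1]C[k+1] n k))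

absorptionℚ : ∀ n k → fromℕ (suc n C suc k) * 1/ℕ suc n ≡ fromℕ (n C k) * 1/ℕ suc k
absorptionℚ n k = begin
  fromℕ (suc n C suc k) * 1/ℕ suc n  ≡⟨ /ℕ≡*1/ℕ (+ (suc n C suc k)) (suc n) ⟨
  (+ (suc n C suc k)) /ℕ suc n       ≡⟨ /ℕ-cross (+ (suc n C suc k)) n (+ (n C k)) k cross ⟩
  (+ (n C k)) /ℕ suc k               ≡⟨ /ℕ≡*1/ℕ (+ (n C k)) (suc k) ⟩
  fromℕ (n C k) * 1/ℕ suc k          ∎
  where
  cross : + (suc n C suc k) ℤ.* + suc k ≡ + (n C k) ℤ.* + suc n
  cross = begin
    + (suc n C suc k) ℤ.* + suc k   ≡⟨ ℤ.pos-* (suc n C suc k) (suc k) ⟨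
    + ((suc n C suc k) ℕ.* suc k)   ≡⟨ cong +_ (ℕ.*-comm (suc n C suc k) (suc k)) ⟩
    + (suc k ℕ.* (suc n C suc k))   ≡⟨ cong +_ ([k+1]*[n+1]C[k+1]≡[n+1]*nCk n k) ⟩
    + (suc n ℕ.* (n C k))           ≡⟨ cong +_ (ℕ.*-comm (suc n) (n C k)) ⟩
    + ((n C k) ℕ.* suc n)           ≡⟨ ℤ.pos-* (n C k) (suc n) ⟩
    + (n C k) ℤ.* + suc n           ∎

∑-sℚ-suc : ∀ M n (w : ℕ → ℚ) →
  ∑[ j < M ] sℚ (suc n) (suc j) * w j + fromℕ n * (∑[ j < M ] sℚ n (suc j) * w j) ≡ ∑[ j < M ] sℚ n j * w j
∑-sℚ-suc M n w = trans (sym (∑<-linear M (λ j → sℚ (suc n) (suc j) * w j) (λ j → sℚ n (suc j) * w j) (fromℕ n)))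
                       (∑<-cong M (λ j _ → trans (collect (sℚ (suc n) (suc j)) (fromℕ n) (sℚ n (suc j)) (w j))
                                                 (cong (_* w j) (sℚ-suc n j))))
  where
  collect : ∀ a c b x → a * x + c * (b * x) ≡ (a + c * b) * x
  collect = solve-∀ ℚ-ring

∑-Sℚ-suc : ∀ M k (w : ℕ → ℚ) →
  ∑[ m < M ] w m * Sℚ (suc m) (suc k) ≡ ∑[ m < M ] w m * Sℚ m k + fromℕ (suc k) * (∑[ m < M ] w m * Sℚ m (suc k))
∑-Sℚ-suc M k w = trans (∑<-cong M (λ m _ → trans (cong (_*_ (w m)) (Sℚ-suc m k))
                                                 (distrib (w m) (Sℚ m k) (fromℕ (suc k)) (Sℚ m (suc k)))))
                       (∑<-linear M (λ m → w m * Sℚ m k) (λ m → w m * Sℚ m (suc k)) (fromℕ (suc k)))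
  where
  distrib : ∀ a x c y → a * (x + c * y) ≡ a * x + c * (a * y)
  distrib = solve-∀ ℚ-ring

pascal-∑< : ∀ i M (g : ℕ → ℚ) →
  ∑[ m < suc M ] fromℕ (suc i C m) * g m ≡ ∑[ m < M ] fromℕ (i C m) * g (suc m) + ∑[ m < suc M ] fromℕ (i C m) * g m
pascal-∑< i M g = begin
  1ℚ * g 0 + ∑[ m < M ] fromℕ (suc i C suc m) * g (suc m)
    ≡⟨ cong (_+_ (1ℚ * g 0)) (trans (∑<-cong M (λ m _ → pascal-step m)) (∑<-+ M shifted-term term)) ⟩
  1ℚ * g 0 + (∑< M shifted-term + ∑< M term)
    ≡⟨ x+[y+z]≡y+[x+z] (1ℚ * g 0) (∑< M shifted-term) (∑< M term) ⟩
  ∑< M shifted-term + (1ℚ * g 0 + ∑< M term) ∎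
  where
  shifted-term term : ℕ → ℚ
  shifted-term m = fromℕ (i C m) * g (suc m)
  term         m = fromℕ (i C suc m) * g (suc m)
  pascal-step : ∀ m → fromℕ (suc i C suc m) * g (suc m) ≡ shifted-term m + term m
  pascal-step m = trans (cong (_* g (suc m)) (sym (pascalℚ i m)))
                        (*-distribʳ-+ (g (suc m)) (fromℕ (i C m)) (fromℕ (i C suc m)))
  x+[y+z]≡y+[x+z] : ∀ x y z → x + (y + z) ≡ y + (x + z)
  x+[y+z]≡y+[x+z] = solve-∀ ℚ-ring

∑C[i,m]S[m,k]≡S[i+1,k+1] : ∀ i k M → i < M → ∑[ m < M ] fromℕ (i C m) * Sℚ m k ≡ Sℚ (suc i) (suc k)
∑C[i,m]S[m,k]≡S[i+1,k+1] zero k (suc M) _ = begin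
  1ℚ * Sℚ 0 k + ∑[ m < M ] 0ℚ * Sℚ (suc m) k
    ≡⟨ cong₂ _+_ (*-identityˡ (Sℚ 0 k)) (∑<-vanish M (λ m _ → *-zeroˡ (Sℚ (suc m) k))) ⟩
  Sℚ 0 k + 0ℚ                  ≡⟨ cong (_+_ (Sℚ 0 k)) (*-zeroʳ (fromℕ (suc k))) ⟨
  Sℚ 0 k + fromℕ (suc k) * 0ℚ  ≡⟨ Sℚ-suc 0 k ⟨
  Sℚ 1 (suc k)                 ∎
∑C[i,m]S[m,k]≡S[i+1,k+1] (suc i) zero (suc M) (s≤s i<M) = begin
  ∑[ m < suc M ] fromℕ (suc i C m) * Sℚ m 0
    ≡⟨ pascal-∑< i M (λ m → Sℚ m 0) ⟩
  ∑[ m < M ] fromℕ (i C m) * 0ℚ + ∑[ m < suc M ] fromℕ (i C m) * Sℚ m 0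
    ≡⟨ cong₂ _+_ (∑<-vanish M (λ m _ → *-zeroʳ (fromℕ (i C m))))
                 (∑C[i,m]S[m,k]≡S[i+1,k+1] i 0 (suc M) (ℕ.m<n⇒m<1+n i<M)) ⟩
  0ℚ + Sℚ (suc i) 1             ≡⟨ cong (_+_ 0ℚ) (*-identityˡ (Sℚ (suc i) 1)) ⟨
  0ℚ + 1ℚ * Sℚ (suc i) 1        ≡⟨ Sℚ-suc (suc i) 0 ⟨
  Sℚ (suc (suc i)) 1            ∎
∑C[i,m]S[m,k]≡S[i+1,k+1] (suc i) (suc k) (suc M) (s≤s i<M) = begin
  ∑[ m < suc M ] fromℕ (suc i C m) * Sℚ m (suc k)
    ≡⟨ pascal-∑< i M (λ m → Sℚ m (suc k)) ⟩
  ∑[ m < M ] fromℕ (i C m) * Sℚ (suc m) (suc k) + ∑[ m < suc M ] fromℕ (i C m) * Sℚ m (suc k)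
    ≡⟨ cong₂ _+_ (∑-Sℚ-suc M k (fromℕ ∘ (i C_)))
                 (∑C[i,m]S[m,k]≡S[i+1,k+1] i (suc k) (suc M) (ℕ.m<n⇒m<1+n i<M)) ⟩
  ∑[ m < M ] fromℕ (i C m) * Sℚ m k + fromℕ (suc k) * (∑[ m < M ] fromℕ (i C m) * Sℚ m (suc k)) + S₁
    ≡⟨ cong₂ (λ x y → x + fromℕ (suc k) * y + S₁)
             (∑C[i,m]S[m,k]≡S[i+1,k+1] i k M i<M) (∑C[i,m]S[m,k]≡S[i+1,k+1] i (suc k) M i<M) ⟩
  Sℚ (suc i) (suc k) + fromℕ (suc k) * S₁ + S₁      ≡⟨ x+ny+y≡x+[n+1]y (Sℚ (suc i) (suc k)) (suc k) S₁ ⟩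
  Sℚ (suc i) (suc k) + fromℕ (suc (suc k)) * S₁     ≡⟨ Sℚ-suc (suc i) (suc k) ⟨
  Sℚ (suc (suc i)) (suc (suc k))                    ∎
  where
  S₁ = Sℚ (suc i) (suc (suc k))

∑s[n+1,j]C[j,p]≡s[n+1,p]+[n+1]s[n,p] : ∀ n M → (∀ p → ∑[ j < M ] sℚ (suc n) (suc j) * fromℕ (j C p) ≡ sℚ n p) →
  ∀ p → ∑[ j < suc M ] sℚ (suc n) j * fromℕ (j C p) ≡ sℚ (suc n) p + fromℕ (suc n) * sℚ n p
∑s[n+1,j]C[j,p]≡s[n+1,p]+[n+1]s[n,p] n M previous-row zero = begin
  0ℚ * 1ℚ + ∑[ j < M ] sℚ (suc n) (suc j) * 1ℚ
    ≡⟨ cong (_+_ (0ℚ * 1ℚ)) (previous-row 0) ⟩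
  0ℚ + sℚ n 0
    ≡⟨ cong (_+ sℚ n 0) (trans (+-identityˡ (fromℕ n * sℚ n 0)) (n*s[n,0]≡0 n)) ⟨
  0ℚ + fromℕ n * sℚ n 0 + sℚ n 0  ≡⟨ x+ny+y≡x+[n+1]y 0ℚ n (sℚ n 0) ⟩
  0ℚ + fromℕ (suc n) * sℚ n 0     ∎
∑s[n+1,j]C[j,p]≡s[n+1,p]+[n+1]s[n,p] n M previous-row (suc p) = begin
  0ℚ * 0ℚ + ∑[ j < M ] sℚ (suc n) (suc j) * fromℕ (suc j C suc p)
    ≡⟨ cong (_+_ (0ℚ * 0ℚ)) (trans (∑<-cong M (λ j _ → pascal-step j)) (∑<-+ M (term p) (term (suc p)))) ⟩
  0ℚ + (∑< M (term p) + ∑< M (term (suc p)))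
    ≡⟨ +-identityˡ (∑< M (term p) + ∑< M (term (suc p))) ⟩
  ∑< M (term p) + ∑< M (term (suc p))
    ≡⟨ cong₂ _+_ (previous-row p) (previous-row (suc p)) ⟩
  sℚ n p + sℚ n (suc p)                                       ≡⟨ cong (_+ sℚ n (suc p)) (sℚ-suc n p) ⟨
  sℚ (suc n) (suc p) + fromℕ n * sℚ n (suc p) + sℚ n (suc p)
    ≡⟨ x+ny+y≡x+[n+1]y (sℚ (suc n) (suc p)) n (sℚ n (suc p)) ⟩
  sℚ (suc n) (suc p) + fromℕ (suc n) * sℚ n (suc p)           ∎
  where
  term : ℕ → ℕ → ℚ
  term q j = sℚ (suc n) (suc j) * fromℕ (j C q)
  pascal-step : ∀ j → sℚ (suc n) (suc j) * fromℕ (suc j C suc p) ≡ term p j + term (suc p) j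
  pascal-step j = trans (cong (_*_ (sℚ (suc n) (suc j))) (sym (pascalℚ j p)))
                        (*-distribˡ-+ (sℚ (suc n) (suc j)) (fromℕ (j C p)) (fromℕ (j C suc p)))

∑s[n+1,j+1]C[j,p]≡s[n,p] : ∀ n p M → n < M → ∑[ j < M ] sℚ (suc n) (suc j) * fromℕ (j C p) ≡ sℚ n p
∑s[n+1,j+1]C[j,p]≡s[n,p] zero p (suc M) _ = begin
  1ℚ * fromℕ (0 C p) + ∑[ j < M ] 0ℚ * fromℕ (suc j C p)
    ≡⟨ cong (_+_ (1ℚ * fromℕ (0 C p))) (∑<-vanish M (λ j _ → *-zeroˡ (fromℕ (suc j C p)))) ⟩
  1ℚ * fromℕ (0 C p) + 0ℚ  ≡⟨ s₀ p ⟩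
  sℚ 0 p                   ∎
  where
  s₀ : ∀ p → 1ℚ * fromℕ (0 C p) + 0ℚ ≡ sℚ 0 p
  s₀ zero    = refl
  s₀ (suc p) = refl
∑s[n+1,j+1]C[j,p]≡s[n,p] (suc n) p (suc M) (s≤s n<M) = +-cancelʳ (fromℕ (suc n) * sℚ n p) _ _ (begin
  ∑< (suc M) (term (suc n)) + fromℕ (suc n) * sℚ n p
    ≡⟨ cong (λ x → ∑< (suc M) (term (suc n)) + fromℕ (suc n) * x)
            (∑s[n+1,j+1]C[j,p]≡s[n,p] n p (suc M) (ℕ.m<n⇒m<1+n n<M)) ⟨
  ∑< (suc M) (term (suc n)) + fromℕ (suc n) * ∑< (suc M) (term n)
    ≡⟨ ∑-sℚ-suc (suc M) (suc n) (fromℕ ∘ (_C p)) ⟩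
  ∑[ j < suc M ] sℚ (suc n) j * fromℕ (j C p)
    ≡⟨ ∑s[n+1,j]C[j,p]≡s[n+1,p]+[n+1]s[n,p] n M (λ p → ∑s[n+1,j+1]C[j,p]≡s[n,p] n p M n<M) p ⟩
  sℚ (suc n) p + fromℕ (suc n) * sℚ n p ∎)
  where
  term : ℕ → ℕ → ℚ
  term r j = sℚ (suc r) (suc j) * fromℕ (j C p)

∑s[n+1,i]C[i,p+1]/i≡s[n,p]/[p+1] : ∀ n p M → suc n < M →
  ∑[ i < M ] sℚ (suc n) i * fromℕ (i C suc p) * 1/ℕ i ≡ sℚ n p * 1/ℕ suc p
∑s[n+1,i]C[i,p+1]/i≡s[n,p]/[p+1] n p (suc M) (s≤s n<M) = begin
  0ℚ + ∑[ j < M ] sℚ (suc n) (suc j) * fromℕ (suc j C suc p) * 1/ℕ suc j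
    ≡⟨ +-identityˡ _ ⟩
  ∑[ j < M ] sℚ (suc n) (suc j) * fromℕ (suc j C suc p) * 1/ℕ suc j
    ≡⟨ ∑<-cong M (λ j _ → absorption-step j) ⟩
  ∑[ j < M ] sℚ (suc n) (suc j) * fromℕ (j C p) * 1/ℕ suc p
    ≡⟨ *-distribʳ-∑< M (1/ℕ suc p) (λ j → sℚ (suc n) (suc j) * fromℕ (j C p)) ⟨
  (∑[ j < M ] sℚ (suc n) (suc j) * fromℕ (j C p)) * 1/ℕ suc p
    ≡⟨ cong (_* 1/ℕ suc p) (∑s[n+1,j+1]C[j,p]≡s[n,p] n p M n<M) ⟩
  sℚ n p * 1/ℕ suc p ∎
  where
  absorption-step : ∀ j → sℚ (suc n) (suc j) * fromℕ (suc j C suc p) * 1/ℕ suc j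
                        ≡ sℚ (suc n) (suc j) * fromℕ (j C p) * 1/ℕ suc p
  absorption-step j = begin
    sℚ (suc n) (suc j) * fromℕ (suc j C suc p) * 1/ℕ suc j
      ≡⟨ *-assoc (sℚ (suc n) (suc j)) (fromℕ (suc j C suc p)) (1/ℕ suc j) ⟩
    sℚ (suc n) (suc j) * (fromℕ (suc j C suc p) * 1/ℕ suc j)
      ≡⟨ cong (_*_ (sℚ (suc n) (suc j))) (absorptionℚ j p) ⟩
    sℚ (suc n) (suc j) * (fromℕ (j C p) * 1/ℕ suc p)
      ≡⟨ *-assoc (sℚ (suc n) (suc j)) (fromℕ (j C p)) (1/ℕ suc p) ⟨
    sℚ (suc n) (suc j) * fromℕ (j C p) * 1/ℕ suc p ∎

S-row-expansion : ∀ i k M a w → i < M →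
  a * Sℚ i (suc k) * w + fromℕ (suc (suc k)) * (a * Sℚ i (suc (suc k)) * w)
    ≡ ∑[ m < M ] a * fromℕ (i C m) * w * Sℚ m (suc k)
S-row-expansion i k M a w i<M = begin
  a * Sℚ i (suc k) * w + c * (a * Sℚ i (suc (suc k)) * w)
    ≡⟨ factor a (Sℚ i (suc k)) w c (Sℚ i (suc (suc k))) ⟩
  a * w * (Sℚ i (suc k) + c * Sℚ i (suc (suc k)))     ≡⟨ cong (_*_ (a * w)) (Sℚ-suc i (suc k)) ⟨
  a * w * Sℚ (suc i) (suc (suc k))
    ≡⟨ cong (_*_ (a * w)) (∑C[i,m]S[m,k]≡S[i+1,k+1] i (suc k) M i<M) ⟨
  a * w * (∑[ m < M ] fromℕ (i C m) * Sℚ m (suc k))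
    ≡⟨ *-distribˡ-∑< M (a * w) (λ m → fromℕ (i C m) * Sℚ m (suc k)) ⟩
  ∑[ m < M ] a * w * (fromℕ (i C m) * Sℚ m (suc k))
    ≡⟨ ∑<-cong M (λ m _ → reorder a w (fromℕ (i C m)) (Sℚ m (suc k))) ⟩
  ∑[ m < M ] a * fromℕ (i C m) * w * Sℚ m (suc k)    ∎
  where
  c = fromℕ (suc (suc k))
  factor : ∀ a x w c y → a * x * w + c * (a * y * w) ≡ a * w * (x + c * y)
  factor = solve-∀ ℚ-ring
  reorder : ∀ a w b x → a * w * (b * x) ≡ a * b * w * x
  reorder = solve-∀ ℚ-ring

∑s[n+1,i]C[i,m]S[m,k+1]/i : ∀ n k m M → suc n < M →
  (∑[ i < M ] sℚ (suc n) i * fromℕ (i C m) * 1/ℕ i) * Sℚ m (suc k)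
    ≡ sℚ (suc n) m * Sℚ m (suc k) * 1/ℕ m + fromℕ n * (sℚ n m * Sℚ m (suc k) * 1/ℕ m)
∑s[n+1,i]C[i,m]S[m,k+1]/i n k zero M _ = begin
  (∑[ i < M ] sℚ (suc n) i * fromℕ (i C 0) * 1/ℕ i) * 0ℚ
    ≡⟨ *-zeroʳ (∑[ i < M ] sℚ (suc n) i * fromℕ (i C 0) * 1/ℕ i) ⟩
  0ℚ                                                    ≡⟨ *-zeroʳ (fromℕ n) ⟨
  fromℕ n * 0ℚ                                          ≡⟨ cong (_*_ (fromℕ n)) (*-zeroʳ (sℚ n 0 * 0ℚ)) ⟨
  fromℕ n * (sℚ n 0 * 0ℚ * 0ℚ)                           ≡⟨ +-identityˡ (fromℕ n * (sℚ n 0 * 0ℚ * 0ℚ)) ⟨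
  0ℚ + fromℕ n * (sℚ n 0 * 0ℚ * 0ℚ)                      ∎
∑s[n+1,i]C[i,m]S[m,k+1]/i n k (suc p) M n+1<M = begin
  (∑[ i < M ] sℚ (suc n) i * fromℕ (i C suc p) * 1/ℕ i) * S′
    ≡⟨ cong (_* S′) (∑s[n+1,i]C[i,p+1]/i≡s[n,p]/[p+1] n p M n+1<M) ⟩
  sℚ n p * w * S′                                         ≡⟨ cong (λ x → x * w * S′) (sℚ-suc n p) ⟨
  (sℚ (suc n) (suc p) + fromℕ n * sℚ n (suc p)) * w * S′
    ≡⟨ expand (sℚ (suc n) (suc p)) (fromℕ n) (sℚ n (suc p)) w S′ ⟩
  sℚ (suc n) (suc p) * S′ * w + fromℕ n * (sℚ n (suc p) * S′ * w) ∎
  where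
  S′ = Sℚ (suc p) (suc k)
  w = 1/ℕ suc p
  expand : ∀ a c b w x → (a + c * b) * w * x ≡ a * x * w + c * (b * x * w)
  expand = solve-∀ ℚ-ring

-- Summing from i = 0 rather than from i = k is harmless: S(i,k) = 0 for i < k, and 1/ℕ 0 = 0.
stirlingSum : ℕ → ℕ → ℚ
stirlingSum n k = ∑[ i < suc n ] sℚ n i * Sℚ i k * 1/ℕ i

-- After adding stirlingSum (n+1) (k+1), both sides are the double sum Σ_i Σ_m F i m, summed by rows
-- (S-row-expansion) and by columns (∑s[n+1,i]C[i,m]S[m,k+1]/i) respectively.
stirlingSum-shift : ∀ n k → fromℕ (suc (suc k)) * stirlingSum (suc n) (suc (suc k)) ≡ fromℕ n * stirlingSum n (suc k)
stirlingSum-shift n k = +-cancelˡ (stirlingSum (suc n) (suc k)) _ _ (begin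
  stirlingSum (suc n) (suc k) + fromℕ (suc (suc k)) * stirlingSum (suc n) (suc (suc k))
    ≡⟨ ∑<-linear M X Y (fromℕ (suc (suc k))) ⟨
  ∑[ i < M ] (X i + fromℕ (suc (suc k)) * Y i)
    ≡⟨ ∑<-cong M (λ i → S-row-expansion i k M (sℚ (suc n) i) (1/ℕ i)) ⟩
  ∑[ i < M ] ∑[ m < M ] F i m                     ≡⟨ ∑<-comm M M F ⟩
  ∑[ m < M ] ∑[ i < M ] F i m                     ≡⟨ ∑<-cong M (λ m _ → collapse-column m) ⟩
  ∑[ m < M ] (X m + fromℕ n * Z m)                ≡⟨ ∑<-linear M X Z (fromℕ n) ⟩
  stirlingSum (suc n) (suc k) + fromℕ n * ∑< M Z
    ≡⟨ cong (λ x → stirlingSum (suc n) (suc k) + fromℕ n * x) (∑<-extend (suc n) {Z} Z[n+1]≡0) ⟩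
  stirlingSum (suc n) (suc k) + fromℕ n * stirlingSum n (suc k) ∎)
  where
  M = suc (suc n)
  X Y Z : ℕ → ℚ
  X i = sℚ (suc n) i * Sℚ i (suc k) * 1/ℕ i
  Y i = sℚ (suc n) i * Sℚ i (suc (suc k)) * 1/ℕ i
  Z i = sℚ n i * Sℚ i (suc k) * 1/ℕ i
  F : ℕ → ℕ → ℚ
  F i m = sℚ (suc n) i * fromℕ (i C m) * 1/ℕ i * Sℚ m (suc k)

  collapse-column : ∀ m → ∑[ i < M ] F i m ≡ X m + fromℕ n * Z m
  collapse-column m = trans (sym (*-distribʳ-∑< M (Sℚ m (suc k)) (λ i → sℚ (suc n) i * fromℕ (i C m) * 1/ℕ i)))
                            (∑s[n+1,i]C[i,m]S[m,k+1]/i n k m M (ℕ.n<1+n (suc n)))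

  Z[n+1]≡0 : Z (suc n) ≡ 0ℚ
  Z[n+1]≡0 = begin
    sℚ n (suc n) * Sℚ (suc n) (suc k) * 1/ℕ suc n
      ≡⟨ cong (λ a → fromℤ a * Sℚ (suc n) (suc k) * 1/ℕ suc n) (s-vanish (ℕ.n<1+n n)) ⟩
    0ℚ * Sℚ (suc n) (suc k) * 1/ℕ suc n             ≡⟨ cong (_* 1/ℕ suc n) (*-zeroˡ (Sℚ (suc n) (suc k))) ⟩
    0ℚ * 1/ℕ suc n                                  ≡⟨ *-zeroˡ (1/ℕ suc n) ⟩
    0ℚ                                              ∎

stirlingSum-1 : ∀ n → stirlingSum n 1 ≡ ∑[ j < n ] sℚ n (suc j) * 1/ℕ suc j
stirlingSum-1 n = begin
  sℚ n 0 * 0ℚ * 0ℚ + ∑[ j < n ] sℚ n (suc j) * Sℚ (suc j) 1 * 1/ℕ suc j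
    ≡⟨ cong₂ _+_ (*-zeroʳ (sℚ n 0 * 0ℚ)) (∑<-cong n (λ j _ → S-one j)) ⟩
  0ℚ + ∑[ j < n ] sℚ n (suc j) * 1/ℕ suc j
    ≡⟨ +-identityˡ _ ⟩
  ∑[ j < n ] sℚ n (suc j) * 1/ℕ suc j ∎
  where
  S-one : ∀ j → sℚ n (suc j) * Sℚ (suc j) 1 * 1/ℕ suc j ≡ sℚ n (suc j) * 1/ℕ suc j
  S-one j = cong (_* 1/ℕ suc j) (trans (cong (λ x → sℚ n (suc j) * fromℤ x) (S[n+1,1]≡1 j)) (*-identityʳ (sℚ n (suc j))))

stirlingSum-recurrence : ∀ m → stirlingSum (suc (suc m)) 1 + fromℕ (suc m) * stirlingSum (suc m) 1 ≡ Bstar (suc m)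
stirlingSum-recurrence m = begin
  stirlingSum (suc (suc m)) 1 + fromℕ (suc m) * stirlingSum (suc m) 1
    ≡⟨ cong₂ (λ x y → x + fromℕ (suc m) * y) (stirlingSum-1 (suc (suc m)))
             (trans (stirlingSum-1 (suc m)) (sym (∑<-extend (suc m) {term} top-term≡0))) ⟩
  ∑[ j < suc (suc m) ] sℚ (suc (suc m)) (suc j) * 1/ℕ suc j + fromℕ (suc m) * ∑< (suc (suc m)) term
    ≡⟨ ∑-sℚ-suc (suc (suc m)) (suc m) (λ j → 1/ℕ suc j) ⟩
  ∑[ j < suc (suc m) ] sℚ (suc m) j * 1/ℕ suc j
    ≡⟨ ∑<-cong (suc (suc m)) (λ j _ → /ℕ≡*1/ℕ (s (suc m) j) (suc j)) ⟨
  ∑[ j < suc (suc m) ] s (suc m) j /ℕ suc j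
    ≡⟨ sumFrom≡∑< 0 (suc (suc m)) (λ j → s (suc m) j /ℕ suc j) ⟨
  Bstar (suc m) ∎
  where
  term : ℕ → ℚ
  term j = sℚ (suc m) (suc j) * 1/ℕ suc j
  top-term≡0 : term (suc m) ≡ 0ℚ
  top-term≡0 = trans (cong (λ a → fromℤ a * 1/ℕ suc (suc m)) (s-vanish (ℕ.n<1+n (suc m)))) (*-zeroˡ (1/ℕ suc (suc m)))

stirlingSum-closed : ∀ k m → fromℕ (suc k !) * stirlingSum (suc k ℕ.+ m) (suc k)
                           ≡ fromℕ ((k ℕ.+ m) !) * (sgn m * Σ[ 0 ≤i≤ m ] (λ ℓ → sgn ℓ * 1/ℕ (ℓ !) * Bstar ℓ))
stirlingSum-closed zero    m = trans (*-identityˡ (stirlingSum (suc m) 1))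
  (first-order-recurrence (λ m → stirlingSum (suc m) 1) Bstar refl stirlingSum-recurrence m)
stirlingSum-closed (suc k) m = begin
  fromℕ (suc (suc k) !) * stirlingSum (suc (suc k) ℕ.+ m) (suc (suc k))
    ≡⟨ cong (_* stirlingSum (suc (suc k) ℕ.+ m) (suc (suc k))) (fromℕ-* (suc (suc k)) (suc k !)) ⟩
  fromℕ (suc (suc k)) * fromℕ (suc k !) * stirlingSum (suc (suc k) ℕ.+ m) (suc (suc k))
    ≡⟨ x*y*z≡y*[x*z] (fromℕ (suc (suc k))) (fromℕ (suc k !)) (stirlingSum (suc (suc k) ℕ.+ m) (suc (suc k))) ⟩
  fromℕ (suc k !) * (fromℕ (suc (suc k)) * stirlingSum (suc (suc k) ℕ.+ m) (suc (suc k)))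
    ≡⟨ cong (_*_ (fromℕ (suc k !))) (stirlingSum-shift (suc k ℕ.+ m) k) ⟩
  fromℕ (suc k !) * (fromℕ (suc k ℕ.+ m) * stirlingSum (suc k ℕ.+ m) (suc k))
    ≡⟨ x*[y*z]≡y*[x*z] (fromℕ (suc k !)) (fromℕ (suc k ℕ.+ m)) (stirlingSum (suc k ℕ.+ m) (suc k)) ⟩
  fromℕ (suc k ℕ.+ m) * (fromℕ (suc k !) * stirlingSum (suc k ℕ.+ m) (suc k))
    ≡⟨ cong (_*_ (fromℕ (suc k ℕ.+ m))) (stirlingSum-closed k m) ⟩
  fromℕ (suc k ℕ.+ m) * (fromℕ ((k ℕ.+ m) !) * B)
    ≡⟨ *-assoc (fromℕ (suc k ℕ.+ m)) (fromℕ ((k ℕ.+ m) !)) B ⟨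
  fromℕ (suc k ℕ.+ m) * fromℕ ((k ℕ.+ m) !) * B
    ≡⟨ cong (_* B) (fromℕ-* (suc k ℕ.+ m) ((k ℕ.+ m) !)) ⟨
  fromℕ ((suc k ℕ.+ m) !) * B ∎
  where
  B = sgn m * Σ[ 0 ≤i≤ m ] (λ ℓ → sgn ℓ * 1/ℕ (ℓ !) * Bstar ℓ)
  x*y*z≡y*[x*z] : ∀ x y z → x * y * z ≡ y * (x * z)
  x*y*z≡y*[x*z] = solve-∀ ℚ-ring
  x*[y*z]≡y*[x*z] : ∀ x y z → x * (y * z) ≡ y * (x * z)
  x*[y*z]≡y*[x*z] = solve-∀ ℚ-ring

Σ≡stirlingSum : ∀ n k → k ≤ suc n → Σ[ k ≤i≤ n ] (λ i → (s n i ℤ.* S i k) /ℕ i) ≡ stirlingSum n k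
Σ≡stirlingSum n k k≤n+1 = begin
  sumFrom k (suc n ∸ k) f
    ≡⟨ ∑<≡sumFrom k (suc n) f k≤n+1 (λ i i<k → trans (as-product i) (vanishes i i<k)) ⟨
  ∑< (suc n) f              ≡⟨ ∑<-cong (suc n) (λ i _ → as-product i) ⟩
  stirlingSum n k           ∎
  where
  f : ℕ → ℚ
  f i = (s n i ℤ.* S i k) /ℕ i
  as-product : ∀ i → f i ≡ sℚ n i * Sℚ i k * 1/ℕ i
  as-product i = trans (/ℕ≡*1/ℕ (s n i ℤ.* S i k) i) (cong (_* 1/ℕ i) (fromℤ-* (s n i) (S i k)))
  vanishes : ∀ i → i < k → sℚ n i * Sℚ i k * 1/ℕ i ≡ 0ℚ
  vanishes i i<k = begin
    sℚ n i * Sℚ i k * 1/ℕ i   ≡⟨ cong (λ b → sℚ n i * fromℤ b * 1/ℕ i) (S-vanish i<k) ⟩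
    sℚ n i * 0ℚ * 1/ℕ i       ≡⟨ cong (_* 1/ℕ i) (*-zeroʳ (sℚ n i)) ⟩
    0ℚ * 1/ℕ i                ≡⟨ *-zeroˡ (1/ℕ i) ⟩
    0ℚ                        ∎

corollary5 : (n k : ℕ) → 1 ≤ k → k ≤ n →
    Σ[ k ≤i≤ n ] (λ i → (s n i ℤ.* S i k) /ℕ i)
      ≡ sgn (n ∸ k) * ((+ ((n ∸ 1) !)) /ℕ (k !))
          * Σ[ 0 ≤i≤ n ∸ k ] (λ ℓ → (sgn ℓ * ((+ 1) /ℕ (ℓ !))) * Bstar ℓ)
corollary5 n zero    () _
corollary5 n (suc k) _  k<n with ℕ.m≤n⇒∃[o]m+o≡n k<n
... | m , refl = begin
  Σ[ suc k ≤i≤ n ] (λ i → (s n i ℤ.* S i (suc k)) /ℕ i)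
    ≡⟨ Σ≡stirlingSum n (suc k) (ℕ.m≤n⇒m≤1+n k<n) ⟩
  stirlingSum n (suc k)
    ≡⟨ fromℕ*x≡y⇒x≡y*1/ℕ (suc k !) {{suc k ℕ.!≢0}} (stirlingSum n (suc k)) _ (stirlingSum-closed k m) ⟩
  fromℕ ((k ℕ.+ m) !) * (sgn m * Σₘ) * 1/ℕ (suc k !)
    ≡⟨ rearrange (fromℕ ((k ℕ.+ m) !)) (sgn m) Σₘ (1/ℕ (suc k !)) ⟩
  sgn m * (fromℕ ((k ℕ.+ m) !) * 1/ℕ (suc k !)) * Σₘ
    ≡⟨ cong (λ x → sgn m * x * Σₘ) (/ℕ≡*1/ℕ (+ ((k ℕ.+ m) !)) (suc k !)) ⟨
  sgn m * ((+ ((k ℕ.+ m) !)) /ℕ (suc k !)) * Σₘ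
    ≡⟨ cong (λ d → sgn d * ((+ ((k ℕ.+ m) !)) /ℕ (suc k !)) * Σ[ 0 ≤i≤ d ] g) (ℕ.m+n∸m≡n (suc k) m) ⟨
  sgn (n ∸ suc k) * ((+ ((n ∸ 1) !)) /ℕ (suc k !)) * Σ[ 0 ≤i≤ n ∸ suc k ] g ∎
  where
  g : ℕ → ℚ
  g ℓ = sgn ℓ * 1/ℕ (ℓ !) * Bstar ℓ
  Σₘ = Σ[ 0 ≤i≤ m ] g
  rearrange : ∀ f σ Σ q → f * (σ * Σ) * q ≡ σ * (f * q) * Σ
  rearrange = solve-∀ ℚ-ring
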